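{- For $n\geq 2$, \[ d_n^B(q)=(2n-1)q\,d_{n-1}^B(q)+2q(1-q)\,\frac{d}{dq}d_{n-1}^{B}(q)+2(n-1)q\,d_{n-2}^B(q). \]
   Context: Let $B_n$ be the set of signed permutations $\sigma=\sigma_1\cdots\sigma_n$ of $[n]=\{1,\dots,n\}$ (permutations of $[n]$ in which some entries carry a minus sign). An index $i\in[n]$ is a type $B$ excedance of $\sigma$ if either $\sigma_i=-i$ or $\sigma_{|\sigma_i|}>\sigma_i$; $\mathrm{exc}_B(\sigma)$ denotes the number of type $B$ excedances. A type $B$ derangement is $\sigma\in B_n$ with $\sigma_i\neq i$ for all $i\in[n]$ (entries $\sigma_i=-i$ are allowed); $D_n^B$ is the set of these. Define $d_n^B(q)=\sum_{\sigma\in D_n^B}q^{\mathrm{exc}_B(\sigma)}$ for $n\geq1$ and $d_0^B(q)=1$. -}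

module Defs where

open import Data.Bool using (Bool; true; false; _∧_; _∨_; not; if_then_else_)
open import Data.Nat as ℕ using (ℕ; zero; suc)
open import Data.Fin as Fin using (Fin; toℕ)
open import Data.Fin.Properties using () renaming (_≟_ to _≟ᶠ_)
open import Data.Integer as ℤ using (ℤ; +_; -_)
open import Data.List as List using (List; []; _∷_; allFin; concatMap; filter; map; foldr)
open import Data.Bool.ListAction using (and)
open import Data.Vec as Vec using (Vec; []; _∷_; lookup)
open import Data.Product using (_×_; _,_; proj₁; proj₂)
open import Relation.Nullary.Decidable using (⌊_⌋)

-- A signed permutation of [n] in one-line notation: entry i (0-based
-- position i stands for position i+1) is a pair (a , s) meaning the value
-- ±(a+1), with s = true meaning a minus sign.
SignedWord : ℕ → Set
SignedWord n = Vec (Fin n × Bool) n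

allVecs : {A : Set} → List A → (m : ℕ) → List (Vec A m)
allVecs xs zero    = [] ∷ []
allVecs xs (suc m) = concatMap (λ x → map (x ∷_) (allVecs xs m)) xs

signedLetters : (n : ℕ) → List (Fin n × Bool)
signedLetters n = concatMap (λ a → (a , false) ∷ (a , true) ∷ []) (allFin n)

isPermB : {n : ℕ} → SignedWord n → Bool
isPermB {n} w =
  and (map (λ i → and (map (λ j →
      ⌊ i ≟ᶠ j ⌋ ∨ not ⌊ proj₁ (lookup w i) ≟ᶠ proj₁ (lookup w j) ⌋)
    (allFin n))) (allFin n))

signedPerms : (n : ℕ) → List (SignedWord n)
signedPerms n = filter (λ w → Data.Bool._≟_ (isPermB w) true) (allVecs (signedLetters n) n)
  where import Data.Bool

val : {n : ℕ} → Fin n × Bool → ℤ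
val (a , false) = + suc (toℕ a)
val (a , true)  = - (+ suc (toℕ a))

pos : {n : ℕ} → Fin n → ℤ
pos i = + suc (toℕ i)

isExcB : {n : ℕ} → SignedWord n → Fin n → Bool
isExcB w i =
  ⌊ val (lookup w i) ℤ.≟ ℤ.- pos i ⌋ ∨
  ⌊ val (lookup w i) ℤ.<? val (lookup w (proj₁ (lookup w i))) ⌋

excB : {n : ℕ} → SignedWord n → ℕ
excB {n} w = List.length (filter (λ i → Data.Bool._≟_ (isExcB w i) true) (allFin n))
  where import Data.Bool

-- type B derangement: σ_i ≠ i for every i (σ_i = -i allowed)
isDerangementB : {n : ℕ} → SignedWord n → Bool
isDerangementB {n} w = and (map (λ i → not ⌊ val (lookup w i) ℤ.≟ pos i ⌋) (allFin n))

derangementsB : (n : ℕ) → List (SignedWord n)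
derangementsB n = filter (λ w → Data.Bool._≟_ (isDerangementB w) true) (signedPerms n)
  where import Data.Bool

sumℤ : List ℤ → ℤ
sumℤ = foldr ℤ._+_ (+ 0)

dB : ℕ → ℤ → ℤ
dB zero    q = + 1
dB (suc n) q = sumℤ (map (λ w → q ℤ.^ excB w) (derangementsB (suc n)))

-- the formal derivative (d/dq) d_n^B(q), evaluated at q:
-- Σ_{σ ∈ D_n^B} exc_B(σ) q^(exc_B(σ) - 1)
dB′ : ℕ → ℤ → ℤ
dB′ zero    q = + 0
dB′ (suc n) q = sumℤ (map (λ w → + excB w ℤ.* q ℤ.^ (excB w ℕ.∸ 1)) (derangementsB (suc n)))

-- Every σ ∈ B_n arises exactly once by inserting the letter ±n into some τ ∈ B_{n-1}: either as
-- the new cycle n ↦ ±n, or right after some j in its cycle (σ_j = ±n, σ_n = τ_j).  The first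
-- kind gives a derangement iff the sign is − and τ is one, and it adds one excedance.  The second
-- kind gives a derangement iff j is the only possible fixed point of τ; writing j = |τ_p|, σ has as
-- many excedances as τ if p is an excedance of τ and one more otherwise, whatever the sign.  So a
-- derangement τ with e excedances contributes q·q^e + 2e·q^e + 2(n-1-e)·q^(e+1), which is
-- (2n-1)q·q^e + 2q(1-q)·e·q^(e-1), while a τ whose only fixed point is j ↦ j contributes
-- 2q·q^(exc τ); deleting that fixed point maps these τ bijectively and exc-preservingly onto
-- D_{n-2}^B, which yields the term 2(n-1)q·d_{n-2}^B.

module Submission where

import Algebra.Properties.CommutativeMonoid.Sum as CommutativeMonoidSum
import Algebra.Properties.Semiring.Sum as SemiringSum
open import Data.Bool as Bool using (Bool; true; false; _∧_; _∨_; not; if_then_else_)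
import Data.Bool.Properties as BoolP
open import Data.Bool.ListAction using (and)
open import Data.Empty using (⊥-elim)
open import Data.Fin as Fin using (Fin; zero; suc; toℕ; punchIn; punchOut; fromℕ)
import Data.Fin.Properties as FinP
open import Data.Fin.Permutation as Perm using (Permutation; permutation; _⟨$⟩ʳ_)
open import Data.Fin.Permutation.Components using (transpose; transpose-inverse)
open import Data.Integer as ℤ using (ℤ; +_; _+_; _-_; _*_)
import Data.Integer.Properties as ℤP
open import Data.Integer.Tactic.RingSolver using (solve-∀)
import Data.Nat.Tactic.RingSolver as NatSolver
open import Data.List as List using (List; []; _∷_; _++_; map; filter; foldr; allFin; tabulate; cartesianProduct)
import Data.List.Properties as ListP
open import Data.List.Membership.Propositional using (_∈_)
import Data.List.Membership.Propositional.Properties as ∈P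
open import Data.List.Membership.Propositional.Properties.WithK using (unique∧set⇒bag)
open import Data.List.Relation.Binary.BagAndSetEquality using (∼bag⇒↭)
open import Data.List.Relation.Binary.Permutation.Propositional using (_↭_; ↭⇒↭ₛ)
import Data.List.Relation.Binary.Permutation.Propositional.Properties as ↭P
open import Data.List.Relation.Binary.Permutation.Setoid.Properties using (foldr-commMonoid)
open import Data.List.Relation.Unary.Any using (here; there)
open import Data.List.Relation.Unary.Unique.Propositional using (Unique)
open import Data.List.Relation.Unary.AllPairs using ([]; _∷_)
open import Data.List.Relation.Unary.All using ([]; _∷_)
import Data.List.Relation.Unary.Unique.Propositional.Properties as UniqueP
open import Data.Nat as ℕ using (ℕ; zero; suc)
import Data.Nat.Properties as ℕP
open import Data.Product using (_×_; _,_; proj₁; proj₂; ∃; uncurry)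
open import Data.Vec as Vec using (Vec; lookup)
import Data.Vec.Properties as VecP
import Data.Vec.Functional as VF
open import Function using (_∘_; _⇔_; mk⇔; Injective)
open import Relation.Nullary using (¬_; Dec; yes; no)
open import Relation.Nullary.Decidable using (⌊_⌋; isYes≗does; does-⇔; dec-true; dec-false)
open import Relation.Binary.PropositionalEquality

open import Defs

private variable
  n : ℕ
  A B X Y : Set

sumOver : List X → (X → ℤ) → ℤ
sumOver xs f = sumℤ (map f xs)

sumOver-++ : (xs ys : List X) (f : X → ℤ) → sumOver (xs ++ ys) f ≡ sumOver xs f + sumOver ys f
sumOver-++ [] ys f = sym (ℤP.+-identityˡ _)
sumOver-++ (x ∷ xs) ys f = trans (cong (_+_ (f x)) (sumOver-++ xs ys f)) (sym (ℤP.+-assoc (f x) _ _))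

sumOver-cong : (xs : List X) {f g : X → ℤ} → (∀ x → x ∈ xs → f x ≡ g x) → sumOver xs f ≡ sumOver xs g
sumOver-cong []       f≗g = refl
sumOver-cong (x ∷ xs) f≗g = cong₂ _+_ (f≗g x (here refl)) (sumOver-cong xs (λ y y∈xs → f≗g y (there y∈xs)))

sumOver-+ : (xs : List X) (f g : X → ℤ) → sumOver xs (λ x → f x + g x) ≡ sumOver xs f + sumOver xs g
sumOver-+ []       f g = refl
sumOver-+ (x ∷ xs) f g rewrite sumOver-+ xs f g = medial (f x) (g x) (sumOver xs f) (sumOver xs g)
  where
  medial : ∀ a b c d → (a + b) + (c + d) ≡ (a + c) + (b + d)
  medial = solve-∀

sumOver-*ˡ : (xs : List X) (c : ℤ) (f : X → ℤ) → sumOver xs (λ x → c * f x) ≡ c * sumOver xs f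
sumOver-*ˡ []       c f = sym (ℤP.*-zeroʳ c)
sumOver-*ˡ (x ∷ xs) c f rewrite sumOver-*ˡ xs c f = sym (ℤP.*-distribˡ-+ c (f x) (sumOver xs f))

sumOver-zero : (xs : List X) → sumOver xs (λ _ → + 0) ≡ + 0
sumOver-zero []       = refl
sumOver-zero (x ∷ xs) = cong (_+_ (+ 0)) (sumOver-zero xs)

sumOver-map : (g : Y → X) (ys : List Y) (f : X → ℤ) → sumOver (map g ys) f ≡ sumOver ys (f ∘ g)
sumOver-map g ys f = cong sumℤ (sym (ListP.map-∘ ys))

sumOver-filter : (p : X → Bool) (xs : List X) (f : X → ℤ) →
                 sumOver (filter (λ x → p x Bool.≟ true) xs) f ≡ sumOver xs (λ x → if p x then f x else + 0)
sumOver-filter p []       f = refl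
sumOver-filter p (x ∷ xs) f with p x
... | true  = cong (_+_ (f x)) (sumOver-filter p xs f)
... | false = trans (sumOver-filter p xs f) (sym (ℤP.+-identityˡ _))

sumOver-cartesianProduct : (xs : List X) (ys : List Y) (f : X × Y → ℤ) →
                           sumOver (cartesianProduct xs ys) f ≡ sumOver xs (λ x → sumOver ys (λ y → f (x , y)))
sumOver-cartesianProduct []       ys f = refl
sumOver-cartesianProduct (x ∷ xs) ys f =
  trans (sumOver-++ (map (x ,_) ys) _ f)
        (cong₂ _+_ (sumOver-map (x ,_) ys f) (sumOver-cartesianProduct xs ys f))

sumOver-↭ : {xs ys : List X} → xs ↭ ys → (f : X → ℤ) → sumOver xs f ≡ sumOver ys f
sumOver-↭ xs↭ys f =
  foldr-commMonoid (setoid ℤ) ℤP.+-0-isCommutativeMonoid (↭⇒↭ₛ (↭P.map⁺ f xs↭ys))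

sumOver-unique : {xs ys : List X} → Unique xs → Unique ys → (∀ {x} → x ∈ xs ⇔ x ∈ ys) →
                 (f : X → ℤ) → sumOver xs f ≡ sumOver ys f
sumOver-unique xs! ys! xs≈ys = sumOver-↭ (∼bag⇒↭ (unique∧set⇒bag xs! ys! xs≈ys))

module ℤΣ = SemiringSum ℤP.+-*-semiring
module ℕΣ = CommutativeMonoidSum ℕP.+-0-commutativeMonoid
module ∧Σ = CommutativeMonoidSum BoolP.∧-commutativeMonoid
open ℤΣ using (sum-syntax)

indicator : Bool → ℕ
indicator b = if b then 1 else 0

count : (Fin n → Bool) → ℕ
count f = ℕΣ.sum (indicator ∘ f)

every : (Fin n → Bool) → Bool
every = ∧Σ.sum

count-remove : (k : Fin (suc n)) (f : Fin (suc n) → Bool) → count f ≡ indicator (f k) ℕ.+ count (f ∘ punchIn k)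
count-remove k f = ℕΣ.sum-remove {i = k} (indicator ∘ f)

every-remove : (k : Fin (suc n)) (f : Fin (suc n) → Bool) → every f ≡ f k ∧ every (f ∘ punchIn k)
every-remove k f = ∧Σ.sum-remove {i = k} f

count-cong : {f g : Fin n → Bool} → (∀ i → f i ≡ g i) → count f ≡ count g
count-cong f≗g = ℕΣ.sum-cong-≗ (cong indicator ∘ f≗g)

count-permute : (π : Permutation n n) (f : Fin n → Bool) → count f ≡ count (f ∘ (π ⟨$⟩ʳ_))
count-permute π f = ℕΣ.sum-permute (indicator ∘ f) π

every-cong : {f g : Fin n → Bool} → (∀ i → f i ≡ g i) → every f ≡ every g
every-cong = ∧Σ.sum-cong-≗

every-true⁻ : (f : Fin n → Bool) → every f ≡ true → ∀ i → f i ≡ true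
every-true⁻ f all-f zero    with f zero | all-f
... | true | _ = refl
every-true⁻ f all-f (suc i) with f zero | all-f
... | true | all-f′ = every-true⁻ (f ∘ suc) all-f′ i

every-true⁺ : (f : Fin n → Bool) → (∀ i → f i ≡ true) → every f ≡ true
every-true⁺ {zero}  f f≡true = refl
every-true⁺ {suc n} f f≡true rewrite f≡true zero = every-true⁺ (f ∘ suc) (f≡true ∘ suc)

count-update : (p : Fin n) (f g : Fin n → Bool) → (∀ a → a ≢ p → f a ≡ g a) →
               count f ℕ.+ indicator (g p) ≡ count g ℕ.+ indicator (f p)
count-update {suc n} p f g f≗g = begin
  count f ℕ.+ indicator (g p)
    ≡⟨ cong (ℕ._+ indicator (g p)) (count-remove p f) ⟩
  indicator (f p) ℕ.+ count (f ∘ punchIn p) ℕ.+ indicator (g p)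
    ≡⟨ cong (λ c → indicator (f p) ℕ.+ c ℕ.+ indicator (g p)) f≗g′ ⟩
  indicator (f p) ℕ.+ count (g ∘ punchIn p) ℕ.+ indicator (g p)
    ≡⟨ exchange (indicator (f p)) _ (indicator (g p)) ⟩
  indicator (g p) ℕ.+ count (g ∘ punchIn p) ℕ.+ indicator (f p)
    ≡⟨ cong (ℕ._+ indicator (f p)) (count-remove p g) ⟨
  count g ℕ.+ indicator (f p) ∎
  where
  open ≡-Reasoning
  f≗g′ : count (f ∘ punchIn p) ≡ count (g ∘ punchIn p)
  f≗g′ = count-cong (λ a → f≗g (punchIn p a) (FinP.punchInᵢ≢i p a))
  exchange : ∀ x y z → x ℕ.+ y ℕ.+ z ≡ z ℕ.+ y ℕ.+ x
  exchange = NatSolver.solve-∀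

∑-const : (n : ℕ) (c : ℤ) → ∑[ i < n ] c ≡ + n * c
∑-const zero    c = sym (ℤP.*-zeroˡ c)
∑-const (suc n) c rewrite ∑-const n c = lemma c (+ n)
  where
  lemma : ∀ c m → c + m * c ≡ (+ 1 + m) * c
  lemma = solve-∀

∑-if : (e : Fin n → Bool) (a b : ℤ) →
       ∑[ i < n ] (if e i then a else b) + + count e * b ≡ + count e * a + + n * b
∑-if {zero}  e a b = ℤP.+-identityʳ _
∑-if {suc n} e a b with e zero | ∑-if (e ∘ suc) a b
... | true  | ih = trans (lemma₁ a (∑[ i < n ] (if e (suc i) then a else b)) (+ count (e ∘ suc)) b)
                         (trans (cong (λ z → a + z + b) ih) (lemma₂ a (+ count (e ∘ suc)) (+ n) b))
  where
  lemma₁ : ∀ a s c b → (a + s) + (+ 1 + c) * b ≡ a + (s + c * b) + b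
  lemma₁ = solve-∀
  lemma₂ : ∀ a c m b → a + (c * a + m * b) + b ≡ (+ 1 + c) * a + (+ 1 + m) * b
  lemma₂ = solve-∀
... | false | ih = trans (lemma₁ b (∑[ i < n ] (if e (suc i) then a else b)) (+ count (e ∘ suc)))
                         (trans (cong (_+_ b) ih) (lemma₂ a (+ count (e ∘ suc)) (+ n) b))
  where
  lemma₁ : ∀ b s c → (b + s) + c * b ≡ b + (s + c * b)
  lemma₁ = solve-∀
  lemma₂ : ∀ a c m b → b + (c * a + m * b) ≡ c * a + (+ 1 + m) * b
  lemma₂ = solve-∀

+-indicator-cancel : (c : Bool) {x e : ℕ} → x ℕ.+ indicator c ≡ suc e → x ≡ (if c then e else suc e)
+-indicator-cancel true  {x} eq = ℕP.suc-injective (trans (ℕP.+-comm 1 x) eq)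
+-indicator-cancel false {x} eq = trans (sym (ℕP.+-identityʳ x)) eq

indicator-complement : (b : Bool) (e : ℕ) → indicator b ℕ.+ (e ℕ.+ indicator (not b)) ≡ suc e
indicator-complement true  e = cong suc (ℕP.+-identityʳ e)
indicator-complement false e = ℕP.+-comm e 1

if-+ : (c : Bool) (x y : ℤ) → (if c then x else + 0) + (if c then y else + 0) ≡ (if c then x + y else + 0)
if-+ true  x y = refl
if-+ false x y = refl

if-∧-split : (a c : Bool) (v : ℤ) → (if c then v else + 0) ≡ (if not a ∧ c then v else + 0) + (if a ∧ c then v else + 0)
if-∧-split false true  v = sym (ℤP.+-identityʳ v)
if-∧-split true  true  v = sym (ℤP.+-identityˡ v)
if-∧-split a     false v rewrite BoolP.∧-zeroʳ a | BoolP.∧-zeroʳ (not a) = refl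

if-factor : (c : Bool) (a : ℤ) {v w : ℤ} → (c ≡ true → v ≡ a * w) → (if c then v else + 0) ≡ a * (if c then w else + 0)
if-factor true  a v≡aw = v≡aw refl
if-factor false a _    = sym (ℤP.*-zeroʳ a)

double : ∀ x → x + x ≡ + 2 * x
double = solve-∀

odd-coefficient : (m : ℕ) → + (2 ℕ.* suc (suc m) ℕ.∸ 1) ≡ + 1 + + 2 * + suc m
odd-coefficient m = trans (cong +_ (ℕP.+-suc (suc m) (suc m ℕ.+ 0)))
                          (trans (ℤP.pos-+ 1 (2 ℕ.* suc m)) (cong (_+_ (+ 1)) (ℤP.pos-* 2 (suc m))))

-- e ∸ 1 truncates at e = 0, where the factor + e vanishes anyway.
derivative-shift : (q : ℤ) (e : ℕ) → + e * q ℤ.^ (e ℕ.∸ 1) * q ≡ + e * q ℤ.^ e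
derivative-shift q zero    = trans (cong (_* q) (ℤP.*-zeroˡ (q ℤ.^ 0))) (trans (ℤP.*-zeroˡ q) (sym (ℤP.*-zeroˡ (q ℤ.^ 0))))
derivative-shift q (suc e) = trans (ℤP.*-assoc (+ suc e) (q ℤ.^ e) q) (cong (+ suc e *_) (ℤP.*-comm (q ℤ.^ e) q))

foldr-tabulate : (_∙_ : X → Y → Y) (e : Y) (f : Fin n → X) → foldr _∙_ e (tabulate f) ≡ VF.foldr _∙_ e f
foldr-tabulate {n = zero}  _∙_ e f = refl
foldr-tabulate {n = suc n} _∙_ e f = cong (f zero ∙_) (foldr-tabulate _∙_ e (f ∘ suc))

foldr-map-allFin : (_∙_ : X → Y → Y) (e : Y) (f : Fin n → X) → foldr _∙_ e (map f (allFin n)) ≡ VF.foldr _∙_ e f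
foldr-map-allFin _∙_ e f = trans (cong (foldr _∙_ e) (ListP.map-tabulate Function.id f)) (foldr-tabulate _∙_ e f)

sumOver-allFin : (f : Fin n → ℤ) → sumOver (allFin n) f ≡ ∑[ i < n ] f i
sumOver-allFin = foldr-map-allFin _+_ (+ 0)

and-map-allFin : (f : Fin n → Bool) → and (map f (allFin n)) ≡ every f
and-map-allFin = foldr-map-allFin _∧_ true

length-filter-tabulate : (g : Fin n → X) (f : X → Bool) →
                         List.length (filter (λ x → f x Bool.≟ true) (tabulate g)) ≡ count (f ∘ g)
length-filter-tabulate {n = zero}  g f = refl
length-filter-tabulate {n = suc n} g f with f (g zero)
... | true  = cong suc (length-filter-tabulate (g ∘ suc) f)
... | false = length-filter-tabulate (g ∘ suc) f

sumOver-∑-comm : (xs : List X) (f : X → Fin n → ℤ) →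
                 sumOver xs (λ x → ∑[ j < n ] f x j) ≡ ∑[ j < n ] sumOver xs (λ x → f x j)
sumOver-∑-comm {n = zero}  xs f = sumOver-zero xs
sumOver-∑-comm {n = suc n} xs f =
  trans (sumOver-+ xs (λ x → f x zero) (λ x → ∑[ j < n ] f x (suc j)))
        (cong (_+_ (sumOver xs (λ x → f x zero))) (sumOver-∑-comm xs (λ x → f x ∘ suc)))

injective⇒surjective : (f : Fin n → Fin n) → Injective _≡_ _≡_ f → ∀ y → ∃ λ x → f x ≡ y
injective⇒surjective {suc n} f f-inj y with FinP.any? (λ x → f x FinP.≟ y)
... | yes hit = hit
... | no miss with i , j , i<j , gi≡gj ← FinP.pigeonhole (ℕP.n<1+n n) (λ x → punchOut (miss ∘ (x ,_) ∘ sym)) =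
  ⊥-elim (FinP.<⇒≢ i<j (f-inj (FinP.punchOut-injective (miss ∘ (i ,_) ∘ sym) (miss ∘ (j ,_) ∘ sym) gi≡gj)))

injective⇒permutation : (f : Fin n → Fin n) → Injective _≡_ _≡_ f → Permutation n n
injective⇒permutation f f-inj = permutation f f⁻¹ (proj₂ ∘ preimage) (λ x → f-inj (proj₂ (preimage (f x))))
  where
  preimage = injective⇒surjective f f-inj
  f⁻¹ = proj₁ ∘ preimage

∑-reindex : (g : Fin n → Fin n) → Injective _≡_ _≡_ g → (f : Fin n → ℤ) → ∑[ i < n ] f (g i) ≡ ∑[ i < n ] f i
∑-reindex g g-inj f = sym (ℤΣ.∑-permute f (injective⇒permutation g g-inj))

module _ {m : ℕ} (i j : Fin m) where

  transpose-applyˡ : transpose i j i ≡ j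
  transpose-applyˡ rewrite dec-true (i FinP.≟ i) refl = refl

  transpose-applyʳ : transpose i j j ≡ i
  transpose-applyʳ with j FinP.≟ i
  ... | yes j≡i = j≡i
  ... | no _ rewrite dec-true (j FinP.≟ j) refl = refl

  transpose-other : {x : Fin m} → x ≢ i → x ≢ j → transpose i j x ≡ x
  transpose-other {x} x≢i x≢j rewrite dec-false (x FinP.≟ i) x≢i | dec-false (x FinP.≟ j) x≢j = refl

  transpose-injective : Injective _≡_ _≡_ (transpose i j)
  transpose-injective {x} {y} eq =
    trans (sym (transpose-inverse j i)) (trans (cong (transpose j i) eq) (transpose-inverse j i))

punchIn-cases : {P : Fin (suc n) → Set} (k : Fin (suc n)) → P k → (∀ x → P (punchIn k x)) → ∀ y → P y
punchIn-cases {P = P} k Pk Pk↑ y with k FinP.≟ y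
... | yes refl = Pk
... | no k≢y   = subst P (FinP.punchIn-punchOut k≢y) (Pk↑ (punchOut k≢y))

lookup-extensionality : {m : ℕ} (u v : Vec X m) → (∀ x → lookup u x ≡ lookup v x) → u ≡ v
lookup-extensionality u v u≗v =
  trans (sym (VecP.tabulate∘lookup u)) (trans (VecP.tabulate-cong u≗v) (VecP.tabulate∘lookup v))

∨-not⇒implication : (a? : Dec A) (b? : Dec B) → ⌊ a? ⌋ ∨ not ⌊ b? ⌋ ≡ true → B → A
∨-not⇒implication (yes a)  _       _  _ = a
∨-not⇒implication (no ¬a) (yes b)  () _
∨-not⇒implication (no ¬a) (no ¬b)  _  b = ⊥-elim (¬b b)

implication⇒∨-not : (a? : Dec A) (b? : Dec B) → (B → A) → ⌊ a? ⌋ ∨ not ⌊ b? ⌋ ≡ true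
implication⇒∨-not (yes a)  _      _   = refl
implication⇒∨-not (no ¬a) (yes b) b⇒a = ⊥-elim (¬a (b⇒a b))
implication⇒∨-not (no ¬a) (no ¬b) _   = refl

⌊⌋-⇔ : A ⇔ B → (a? : Dec A) (b? : Dec B) → ⌊ a? ⌋ ≡ ⌊ b? ⌋
⌊⌋-⇔ A⇔B a? b? = trans (isYes≗does a?) (trans (does-⇔ A⇔B a? b?) (sym (isYes≗does b?)))

⌊⌋-true : (a? : Dec A) → A → ⌊ a? ⌋ ≡ true
⌊⌋-true a? a = trans (isYes≗does a?) (dec-true a? a)

⌊⌋-false : (a? : Dec A) → ¬ A → ⌊ a? ⌋ ≡ false
⌊⌋-false a? ¬a = trans (isYes≗does a?) (dec-false a? ¬a)

SignedLetter : ℕ → Set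
SignedLetter n = Fin n × Bool

∣_∣ : SignedWord n → Fin n → Fin n
∣ w ∣ i = proj₁ (lookup w i)

IsSignedPerm : SignedWord n → Set
IsSignedPerm w = Injective _≡_ _≡_ ∣ w ∣

isPermB≡every : (w : SignedWord n) →
                isPermB w ≡ every (λ i → every (λ j → ⌊ i FinP.≟ j ⌋ ∨ not ⌊ ∣ w ∣ i FinP.≟ ∣ w ∣ j ⌋))
isPermB≡every {n} w = trans (and-map-allFin {n = n} _) (every-cong {n = n} λ i → and-map-allFin {n = n} _)

isPermB⇒isSignedPerm : (w : SignedWord n) → isPermB w ≡ true → IsSignedPerm w
isPermB⇒isSignedPerm w perm {i} {j} =
  ∨-not⇒implication (i FinP.≟ j) (∣ w ∣ i FinP.≟ ∣ w ∣ j)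
    (every-true⁻ _ (every-true⁻ _ (trans (sym (isPermB≡every w)) perm) i) j)

isSignedPerm⇒isPermB : (w : SignedWord n) → IsSignedPerm w → isPermB w ≡ true
isSignedPerm⇒isPermB w w-inj = trans (isPermB≡every w) (every-true⁺ _ λ i → every-true⁺ _ λ j →
  implication⇒∨-not (i FinP.≟ j) (∣ w ∣ i FinP.≟ ∣ w ∣ j) w-inj)

concatMap-cons≡cartesianProductWith : {m : ℕ} (xs : List X) (ys : List (Vec X m)) →
  List.concatMap (λ x → map (x Vec.∷_) ys) xs ≡ List.cartesianProductWith Vec._∷_ xs ys
concatMap-cons≡cartesianProductWith []       ys = refl
concatMap-cons≡cartesianProductWith (x ∷ xs) ys = cong (map (x Vec.∷_) ys ++_) (concatMap-cons≡cartesianProductWith xs ys)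

∈-allVecs : (xs : List X) → (∀ x → x ∈ xs) → (m : ℕ) (v : Vec X m) → v ∈ allVecs xs m
∈-allVecs xs xs-full zero    Vec.[]       = here refl
∈-allVecs xs xs-full (suc m) (x Vec.∷ v) rewrite concatMap-cons≡cartesianProductWith xs (allVecs xs m) =
  ∈P.∈-cartesianProductWith⁺ Vec._∷_ (xs-full x) (∈-allVecs xs xs-full m v)

allVecs-unique : (xs : List X) → Unique xs → (m : ℕ) → Unique (allVecs xs m)
allVecs-unique xs xs! zero    = [] ∷ []
allVecs-unique xs xs! (suc m) rewrite concatMap-cons≡cartesianProductWith xs (allVecs xs m) =
  UniqueP.cartesianProductWith⁺ Vec._∷_ VecP.∷-injective xs! (allVecs-unique xs xs! m)

signedLetters≡cartesianProduct : (n : ℕ) → signedLetters n ≡ cartesianProduct (allFin n) (false ∷ true ∷ [])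
signedLetters≡cartesianProduct n = go (allFin n)
  where
  go : (as : List (Fin n)) →
       List.concatMap (λ a → (a , false) ∷ (a , true) ∷ []) as ≡ cartesianProduct as (false ∷ true ∷ [])
  go []       = refl
  go (a ∷ as) = cong (λ ls → (a , false) ∷ (a , true) ∷ ls) (go as)

∈-bothSigns : (b : Bool) → b ∈ false ∷ true ∷ []
∈-bothSigns false = here refl
∈-bothSigns true  = there (here refl)

bothSigns-unique : Unique (false ∷ true ∷ [])
bothSigns-unique = ((λ ()) ∷ []) ∷ [] ∷ []

sumOver-signs : {m : ℕ} (g : Fin m × Bool → ℤ) →
                sumOver (cartesianProduct (allFin m) (false ∷ true ∷ [])) g ≡ ∑[ i < m ] (g (i , false) + g (i , true))
sumOver-signs {m} g = begin
  sumOver (cartesianProduct (allFin m) (false ∷ true ∷ [])) g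
    ≡⟨ sumOver-cartesianProduct (allFin m) _ g ⟩
  sumOver (allFin m) (λ i → g (i , false) + (g (i , true) + + 0))
    ≡⟨ sumOver-cong (allFin m) (λ i _ → cong (_+_ (g (i , false))) (ℤP.+-identityʳ _)) ⟩
  sumOver (allFin m) (λ i → g (i , false) + g (i , true))
    ≡⟨ sumOver-allFin (λ i → g (i , false) + g (i , true)) ⟩
  ∑[ i < m ] (g (i , false) + g (i , true)) ∎
  where open ≡-Reasoning

∈-signedLetters : (n : ℕ) (x : SignedLetter n) → x ∈ signedLetters n
∈-signedLetters n (a , s) rewrite signedLetters≡cartesianProduct n =
  ∈P.∈-cartesianProduct⁺ (∈P.∈-allFin a) (∈-bothSigns s)

signedLetters-unique : (n : ℕ) → Unique (signedLetters n)
signedLetters-unique n rewrite signedLetters≡cartesianProduct n =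
  UniqueP.cartesianProduct⁺ (UniqueP.allFin⁺ n) bothSigns-unique

signedPerms-unique : (n : ℕ) → Unique (signedPerms n)
signedPerms-unique n = UniqueP.filter⁺ _ (allVecs-unique _ (signedLetters-unique n) n)

∈-signedPerms⁺ : (w : SignedWord n) → IsSignedPerm w → w ∈ signedPerms n
∈-signedPerms⁺ {n} w w-perm =
  ∈P.∈-filter⁺ _ (∈-allVecs _ (∈-signedLetters n) n w) (isSignedPerm⇒isPermB w w-perm)

∈-signedPerms⁻ : (w : SignedWord n) → w ∈ signedPerms n → IsSignedPerm w
∈-signedPerms⁻ {n} w w∈ = isPermB⇒isSignedPerm w (proj₂ (∈P.∈-filter⁻ _ {xs = allVecs (signedLetters n) n} w∈))

fixedAt : SignedWord n → Fin n → Bool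
fixedAt w i = ⌊ val (lookup w i) ℤ.≟ pos i ⌋

isDerangementB≡every : (w : SignedWord n) → isDerangementB w ≡ every (not ∘ fixedAt w)
isDerangementB≡every w = and-map-allFin (not ∘ fixedAt w)

excB≡count : (w : SignedWord n) → excB w ≡ count (isExcB w)
excB≡count w = length-filter-tabulate Function.id (isExcB w)

dB-term : ℤ → SignedWord n → ℤ
dB-term q w = if isDerangementB w then q ℤ.^ excB w else + 0

dB′-term : ℤ → SignedWord n → ℤ
dB′-term q w = if isDerangementB w then + excB w * q ℤ.^ (excB w ℕ.∸ 1) else + 0

unfixedAwayFrom : Fin (suc n) → SignedWord (suc n) → Bool
unfixedAwayFrom j w = every (not ∘ fixedAt w ∘ punchIn j)

fixedOnlyAt : Fin (suc n) → SignedWord (suc n) → Bool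
fixedOnlyAt j w = fixedAt w j ∧ unfixedAwayFrom j w

fixedOnlyAt-term : ℤ → Fin (suc n) → SignedWord (suc n) → ℤ
fixedOnlyAt-term q j w = if fixedOnlyAt j w then q ℤ.^ excB w else + 0

dB≡sumOver : (n : ℕ) (q : ℤ) → dB n q ≡ sumOver (signedPerms n) (dB-term q)
dB≡sumOver zero    q = refl
dB≡sumOver (suc n) q = sumOver-filter isDerangementB (signedPerms (suc n)) _

dB′≡sumOver : (n : ℕ) (q : ℤ) → dB′ (suc n) q ≡ sumOver (signedPerms (suc n)) (dB′-term q)
dB′≡sumOver n q = sumOver-filter isDerangementB (signedPerms (suc n)) _

val-injective : {u v : SignedLetter n} → val u ≡ val v → u ≡ v
val-injective {u = a , false} {b , false} eq = cong (_, false) (FinP.toℕ-injective (ℕP.suc-injective (ℤP.+-injective eq)))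
val-injective {u = a , true}  {b , true}  eq = cong (_, true) (FinP.toℕ-injective (ℤP.-[1+-injective eq))

fixedAt-letter : (x : Fin n) (b : Bool) → ⌊ val (x , b) ℤ.≟ pos x ⌋ ≡ not b
fixedAt-letter x false = ⌊⌋-true (val (x , false) ℤ.≟ pos x) refl
fixedAt-letter x true  = ⌊⌋-false (val (x , true) ℤ.≟ pos x) (λ ())

fixedAt-true⁻ : (w : SignedWord n) (x : Fin n) → fixedAt w x ≡ true → lookup w x ≡ (x , false)
fixedAt-true⁻ w x fixed with val (lookup w x) ℤ.≟ pos x
... | yes eq = val-injective eq

excedanceTest : SignedLetter n → Fin n → SignedLetter n → Bool
excedanceTest u x v = ⌊ val u ℤ.≟ ℤ.- pos x ⌋ ∨ ⌊ val u ℤ.<? val v ⌋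

excedanceTest-self : (x : Fin n) (b : Bool) → excedanceTest (x , b) x (x , b) ≡ b
excedanceTest-self x b =
  trans (cong₂ _∨_ (negated b) (⌊⌋-false (val (x , b) ℤ.<? val (x , b)) (ℤP.<-irrefl refl))) (BoolP.∨-identityʳ b)
  where
  negated : (b : Bool) → ⌊ val (x , b) ℤ.≟ ℤ.- pos x ⌋ ≡ b
  negated false = ⌊⌋-false (val (x , false) ℤ.≟ ℤ.- pos x) (λ ())
  negated true  = ⌊⌋-true (val (x , true) ℤ.≟ ℤ.- pos x) refl

isExcB-via : (w : SignedWord n) (x : Fin n) {u v : SignedLetter n} →
             lookup w x ≡ u → lookup w (proj₁ u) ≡ v → isExcB w x ≡ excedanceTest u x v
isExcB-via w x refl refl = refl

module Insertion {n : ℕ} (k : Fin (suc n)) where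

  liftLetter : SignedLetter n → SignedLetter (suc n)
  liftLetter (a , s) = punchIn k a , s

  liftLetter-injective : Injective _≡_ _≡_ liftLetter
  liftLetter-injective {a , s} {b , t} eq with FinP.punchIn-injective k a b (cong proj₁ eq) | cong proj₂ eq
  ... | refl | refl = refl

  liftLetter≢k : (u : SignedLetter n) → proj₁ (liftLetter u) ≢ k
  liftLetter≢k (a , _) = FinP.punchInᵢ≢i k a

  val-liftLetter-≤ : (u v : SignedLetter n) → val u ℤ.≤ val v → val (liftLetter u) ℤ.≤ val (liftLetter v)
  val-liftLetter-≤ (a , false) (b , false) (ℤ.+≤+ (ℕ.s≤s a≤b)) = ℤ.+≤+ (ℕ.s≤s (FinP.punchIn-mono-≤ k a b a≤b))
  val-liftLetter-≤ (a , true)  (b , true)  (ℤ.-≤- b≤a)          = ℤ.-≤- (FinP.punchIn-mono-≤ k b a b≤a)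
  val-liftLetter-≤ (a , true)  (b , false) _                     = ℤ.-≤+

  val-liftLetter-≤⁻ : (u v : SignedLetter n) → val (liftLetter u) ℤ.≤ val (liftLetter v) → val u ℤ.≤ val v
  val-liftLetter-≤⁻ (a , false) (b , false) (ℤ.+≤+ (ℕ.s≤s a≤b)) = ℤ.+≤+ (ℕ.s≤s (FinP.punchIn-cancel-≤ k a b a≤b))
  val-liftLetter-≤⁻ (a , true)  (b , true)  (ℤ.-≤- b≤a)          = ℤ.-≤- (FinP.punchIn-cancel-≤ k b a b≤a)
  val-liftLetter-≤⁻ (a , true)  (b , false) _                     = ℤ.-≤+

  val-liftLetter-<? : (u v : SignedLetter n) → ⌊ val (liftLetter u) ℤ.<? val (liftLetter v) ⌋ ≡ ⌊ val u ℤ.<? val v ⌋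
  val-liftLetter-<? u v = ⌊⌋-⇔ (mk⇔
    (λ u↑<v↑ → ℤP.≰⇒> (ℤP.<⇒≱ u↑<v↑ ∘ val-liftLetter-≤ v u))
    (λ u<v → ℤP.≰⇒> (ℤP.<⇒≱ u<v ∘ val-liftLetter-≤⁻ v u))) (val (liftLetter u) ℤ.<? val (liftLetter v)) (val u ℤ.<? val v)

  extend : SignedWord n → Bool → Fin (suc n) → SignedLetter (suc n)
  extend τ b y with k FinP.≟ y
  ... | yes _   = k , b
  ... | no k≢y  = liftLetter (lookup τ (punchOut k≢y))

  -- extend τ b is τ relabelled around k with the new letter (k , b) at position k; composing with the
  -- transposition (i k) of positions puts ±k at position i and the letter extend τ b has at i at position k.
  insert : SignedWord n → Fin (suc n) × Bool → SignedWord (suc n)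
  insert τ (i , b) = Vec.tabulate (extend τ b ∘ transpose i k)

  module _ (τ : SignedWord n) (b : Bool) where

    extend-k : extend τ b k ≡ (k , b)
    extend-k with k FinP.≟ k
    ... | yes _   = refl
    ... | no k≢k = ⊥-elim (k≢k refl)

    extend-punchIn : (x : Fin n) → extend τ b (punchIn k x) ≡ liftLetter (lookup τ x)
    extend-punchIn x with k FinP.≟ punchIn k x
    ... | yes k≡k↑x = ⊥-elim (FinP.punchInᵢ≢i k x (sym k≡k↑x))
    ... | no k≢k↑x  = cong (liftLetter ∘ lookup τ) (FinP.punchOut-punchIn k)

    ∣extend∣-injective : IsSignedPerm τ → Injective _≡_ _≡_ (proj₁ ∘ extend τ b)
    ∣extend∣-injective τ-perm {y} {z} eq with k FinP.≟ y | k FinP.≟ z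
    ... | yes k≡y | yes k≡z = trans (sym k≡y) k≡z
    ... | yes _   | no _    = ⊥-elim (FinP.punchInᵢ≢i k _ (sym eq))
    ... | no _    | yes _   = ⊥-elim (FinP.punchInᵢ≢i k _ eq)
    ... | no k≢y  | no k≢z  = FinP.punchOut-injective k≢y k≢z (τ-perm (FinP.punchIn-injective k _ _ eq))

    ∣extend∣≡k : {y : Fin (suc n)} → proj₁ (extend τ b y) ≡ k → y ≡ k
    ∣extend∣≡k {y} = punchIn-cases {P = λ y → proj₁ (extend τ b y) ≡ k → y ≡ k} k (λ _ → refl)
      (λ x eq → ⊥-elim (liftLetter≢k (lookup τ x) (trans (cong proj₁ (sym (extend-punchIn x))) eq))) y

  module _ (τ : SignedWord n) (i : Fin (suc n)) (b : Bool) where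

    private
      σ = insert τ (i , b)

    lookup-insert : (y : Fin (suc n)) → lookup σ (transpose k i y) ≡ extend τ b y
    lookup-insert y = trans (VecP.lookup∘tabulate (extend τ b ∘ transpose i k) (transpose k i y))
                            (cong (extend τ b) (transpose-inverse i k))

    insert-at-i : lookup σ i ≡ (k , b)
    insert-at-i = trans (cong (lookup σ) (sym (transpose-applyˡ k i))) (trans (lookup-insert k) (extend-k τ b))

    insert-at-transposed : (x : Fin n) → lookup σ (transpose k i (punchIn k x)) ≡ liftLetter (lookup τ x)
    insert-at-transposed x = trans (lookup-insert (punchIn k x)) (extend-punchIn τ b x)

    insert-at-punchIn : (x : Fin n) → punchIn k x ≢ i → lookup σ (punchIn k x) ≡ liftLetter (lookup τ x)
    insert-at-punchIn x k↑x≢i =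
      trans (cong (lookup σ) (sym (transpose-other k i (FinP.punchInᵢ≢i k x) k↑x≢i))) (insert-at-transposed x)

    insert-isSignedPerm : IsSignedPerm τ → IsSignedPerm σ
    insert-isSignedPerm τ-perm {x} {y} eq =
      transpose-injective i k (∣extend∣-injective τ b τ-perm
        (trans (cong proj₁ (sym (lookup-tabulate x))) (trans eq (cong proj₁ (lookup-tabulate y)))))
      where
      lookup-tabulate : ∀ z → lookup σ z ≡ extend τ b (transpose i k z)
      lookup-tabulate = VecP.lookup∘tabulate (extend τ b ∘ transpose i k)

    isExcB-insert : (x : Fin n) → punchIn k (∣ τ ∣ x) ≢ i → isExcB σ (transpose k i (punchIn k x)) ≡ isExcB τ x
    isExcB-insert x k↑∣τx∣≢i = begin
      isExcB σ z
        ≡⟨ isExcB-via σ z (insert-at-transposed x) (insert-at-punchIn (∣ τ ∣ x) k↑∣τx∣≢i) ⟩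
      excedanceTest (liftLetter u) z (liftLetter v)
        ≡⟨ cong₂ _∨_ negation-transfers (val-liftLetter-<? u v) ⟩
      isExcB τ x ∎
      where
      open ≡-Reasoning
      z = transpose k i (punchIn k x)
      u = lookup τ x
      v = lookup τ (∣ τ ∣ x)
      transpose-fixes : transpose k i (punchIn k (∣ τ ∣ x)) ≡ punchIn k (∣ τ ∣ x)
      transpose-fixes = transpose-other k i (FinP.punchInᵢ≢i k (∣ τ ∣ x)) k↑∣τx∣≢i
      to : val (liftLetter u) ≡ ℤ.- pos z → val u ≡ ℤ.- pos x
      to eq = cong val (cong₂ _,_ (FinP.punchIn-injective k _ _ (transpose-injective k i (trans transpose-fixes (cong proj₁ u↑≡))))
                                  (cong proj₂ u↑≡))
        where u↑≡ = val-injective {u = liftLetter u} {z , true} eq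
      from : val u ≡ ℤ.- pos x → val (liftLetter u) ≡ ℤ.- pos z
      from eq = cong val (trans (cong liftLetter u≡) (cong (_, true) (sym z≡)))
        where
        u≡ = val-injective {u = u} {x , true} eq
        z≡ : z ≡ punchIn k x
        z≡ = subst (λ y → transpose k i (punchIn k y) ≡ punchIn k y) (cong proj₁ u≡) transpose-fixes
      negation-transfers : ⌊ val (liftLetter u) ℤ.≟ ℤ.- pos z ⌋ ≡ ⌊ val u ℤ.≟ ℤ.- pos x ⌋
      negation-transfers = ⌊⌋-⇔ (mk⇔ to from) (val (liftLetter u) ℤ.≟ ℤ.- pos z) (val u ℤ.≟ ℤ.- pos x)

    -- Counting positions through the transposition (k i) lines all but position i up with τ's positions.
    excB-insert : excB σ ≡ indicator (isExcB σ i) ℕ.+ count (λ x → isExcB σ (transpose k i (punchIn k x)))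
    excB-insert = begin
      excB σ
        ≡⟨ excB≡count σ ⟩
      count (isExcB σ)
        ≡⟨ count-permute (Perm.transpose k i) (isExcB σ) ⟩
      count (isExcB σ ∘ transpose k i)
        ≡⟨ count-remove k (isExcB σ ∘ transpose k i) ⟩
      indicator (isExcB σ (transpose k i k)) ℕ.+ rest
        ≡⟨ cong (λ y → indicator (isExcB σ y) ℕ.+ rest) (transpose-applyˡ k i) ⟩
      indicator (isExcB σ i) ℕ.+ rest ∎
      where
      open ≡-Reasoning
      rest = count (λ x → isExcB σ (transpose k i (punchIn k x)))

    fixedAt-insert : (x : Fin n) → punchIn k x ≢ i → fixedAt σ (punchIn k x) ≡ fixedAt τ x
    fixedAt-insert x k↑x≢i = trans (cong (λ u → ⌊ val u ℤ.≟ pos (punchIn k x) ⌋) (insert-at-punchIn x k↑x≢i))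
      (⌊⌋-⇔ (mk⇔ to from) (val (liftLetter u) ℤ.≟ pos (punchIn k x)) (val u ℤ.≟ pos x))
      where
      u = lookup τ x
      to : val (liftLetter u) ≡ pos (punchIn k x) → val u ≡ pos x
      to = cong val ∘ liftLetter-injective {u} {x , false} ∘ val-injective {u = liftLetter u} {punchIn k x , false}
      from : val u ≡ pos x → val (liftLetter u) ≡ pos (punchIn k x)
      from = cong (val ∘ liftLetter) ∘ val-injective {u = u} {x , false}

    fixedAt-insert-at-i : k ≢ i → fixedAt σ i ≡ false
    fixedAt-insert-at-i k≢i = trans (cong (λ u → ⌊ val u ℤ.≟ pos i ⌋) insert-at-i)
      (⌊⌋-false (val (k , b) ℤ.≟ pos i) (k≢i ∘ cong proj₁ ∘ val-injective {u = k , b} {i , false}))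

    fixedAt-insert-at-k : k ≢ i → fixedAt σ k ≡ false
    fixedAt-insert-at-k k≢i = ⌊⌋-false (val (lookup σ k) ℤ.≟ pos k)
      (k≢i ∘ sym ∘ ∣extend∣≡k τ b ∘ cong proj₁ ∘ val-injective {u = extend τ b i} {k , false} ∘ trans (cong val (sym σk≡)))
      where
      σk≡ : lookup σ k ≡ extend τ b i
      σk≡ = trans (cong (lookup σ) (sym (transpose-applyʳ k i))) (lookup-insert i)

  module _ (τ : SignedWord n) (b : Bool) where

    private
      σ = insert τ (k , b)

    excB-insert-self : excB σ ≡ indicator b ℕ.+ excB τ
    excB-insert-self = begin
      excB σ
        ≡⟨ excB-insert τ k b ⟩
      indicator (isExcB σ k) ℕ.+ count (λ x → isExcB σ (transpose k k (punchIn k x)))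
        ≡⟨ cong₂ ℕ._+_ (cong indicator new-letter) rest ⟩
      indicator b ℕ.+ count (isExcB τ)
        ≡⟨ cong (indicator b ℕ.+_) (excB≡count τ) ⟨
      indicator b ℕ.+ excB τ ∎
      where
      open ≡-Reasoning
      new-letter : isExcB σ k ≡ b
      new-letter = trans (isExcB-via σ k (insert-at-i τ k b) (insert-at-i τ k b)) (excedanceTest-self k b)
      rest = count-cong (λ x → isExcB-insert τ k b x (FinP.punchInᵢ≢i k (∣ τ ∣ x)))

    isDerangementB-insert-self : isDerangementB σ ≡ b ∧ isDerangementB τ
    isDerangementB-insert-self = begin
      isDerangementB σ                                       ≡⟨ isDerangementB≡every σ ⟩
      every (not ∘ fixedAt σ)                                ≡⟨ every-remove k (not ∘ fixedAt σ) ⟩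
      not (fixedAt σ k) ∧ every (not ∘ fixedAt σ ∘ punchIn k) ≡⟨ cong₂ _∧_ new-letter rest ⟩
      b ∧ every (not ∘ fixedAt τ)                            ≡⟨ cong (b ∧_) (isDerangementB≡every τ) ⟨
      b ∧ isDerangementB τ                                   ∎
      where
      open ≡-Reasoning
      new-letter : not (fixedAt σ k) ≡ b
      new-letter = trans (cong (λ u → not ⌊ val u ℤ.≟ pos k ⌋) (insert-at-i τ k b))
                         (trans (cong not (fixedAt-letter k b)) (BoolP.not-involutive b))
      rest = every-cong (λ x → cong not (fixedAt-insert τ k b x (FinP.punchInᵢ≢i k x)))

  insert-position-injective : {τ τ′ : SignedWord n} {i i′ : Fin (suc n)} {b b′ : Bool} →
                              insert τ (i , b) ≡ insert τ′ (i′ , b′) → i ≡ i′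
  insert-position-injective {τ} {τ′} {i} {i′} {b} {b′} eq =
    transpose-injective i′ k (trans (∣extend∣≡k τ′ b′ (cong proj₁ k-at-i)) (sym (transpose-applyˡ i′ k)))
    where
    k-at-i : extend τ′ b′ (transpose i′ k i) ≡ (k , b)
    k-at-i = trans (sym (VecP.lookup∘tabulate (extend τ′ b′ ∘ transpose i′ k) i))
                   (trans (cong (λ σ → lookup σ i) (sym eq)) (insert-at-i τ i b))

  insert-injective : {τ τ′ : SignedWord n} {c c′ : Fin (suc n) × Bool} → insert τ c ≡ insert τ′ c′ → (τ , c) ≡ (τ′ , c′)
  insert-injective {τ} {τ′} {i , b} {i′ , b′} eq with refl ← insert-position-injective {τ} {τ′} {i} {i′} {b} {b′} eq =
    cong₂ _,_ (lookup-extensionality τ τ′ same-letters) (cong (i ,_) same-sign)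
    where
    same-sign : b ≡ b′
    same-sign = cong proj₂ (trans (sym (insert-at-i τ i b)) (trans (cong (λ σ → lookup σ i) eq) (insert-at-i τ′ i b′)))
    same-letters : ∀ x → lookup τ x ≡ lookup τ′ x
    same-letters x = liftLetter-injective
      (trans (sym (insert-at-transposed τ i b x))
             (trans (cong (λ σ → lookup σ (transpose k i (punchIn k x))) eq) (insert-at-transposed τ′ i b′ x)))

  module _ (σ : SignedWord (suc n)) (σ-perm : IsSignedPerm σ) where

    pivot : Fin (suc n)
    pivot = proj₁ (injective⇒surjective ∣ σ ∣ σ-perm k)

    ∣σ∣-pivot : ∣ σ ∣ pivot ≡ k
    ∣σ∣-pivot = proj₂ (injective⇒surjective ∣ σ ∣ σ-perm k)

    k≢∣σ∣ : (x : Fin n) → k ≢ ∣ σ ∣ (transpose k pivot (punchIn k x))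
    k≢∣σ∣ x k≡∣σ∣ = FinP.punchInᵢ≢i k x (transpose-injective k pivot
      (trans (σ-perm (trans (sym k≡∣σ∣) (sym ∣σ∣-pivot))) (sym (transpose-applyˡ k pivot))))

    contract : SignedWord n
    contract = Vec.tabulate λ x → punchOut (k≢∣σ∣ x) , proj₂ (lookup σ (transpose k pivot (punchIn k x)))

    liftLetter-contract : (x : Fin n) → liftLetter (lookup contract x) ≡ lookup σ (transpose k pivot (punchIn k x))
    liftLetter-contract x =
      trans (cong liftLetter (VecP.lookup∘tabulate _ x))
            (cong (_, proj₂ (lookup σ (transpose k pivot (punchIn k x)))) (FinP.punchIn-punchOut (k≢∣σ∣ x)))

    contract-isSignedPerm : IsSignedPerm contract
    contract-isSignedPerm {x} {y} eq = FinP.punchIn-injective k x y (transpose-injective k pivot (σ-perm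
      (trans (cong proj₁ (sym (liftLetter-contract x))) (trans (cong (punchIn k) eq) (cong proj₁ (liftLetter-contract y))))))

    insert-contract : insert contract (pivot , proj₂ (lookup σ pivot)) ≡ σ
    insert-contract = lookup-extensionality _ σ λ z →
      subst (λ z → lookup σ′ z ≡ lookup σ z) (transpose-inverse k pivot) (agree (transpose pivot k z))
      where
      s = proj₂ (lookup σ pivot)
      σ′ = insert contract (pivot , s)
      agree-k : lookup σ′ (transpose k pivot k) ≡ lookup σ (transpose k pivot k)
      agree-k = trans (lookup-insert contract pivot s k) (trans (extend-k contract s)
                (trans (cong (_, s) (sym ∣σ∣-pivot)) (cong (lookup σ) (sym (transpose-applyˡ k pivot)))))
      agree : ∀ y → lookup σ′ (transpose k pivot y) ≡ lookup σ (transpose k pivot y)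
      agree = punchIn-cases k agree-k (λ x → trans (insert-at-transposed contract pivot s x) (liftLetter-contract x))

  sumOver-signedPerms-insert :
    (F : SignedWord (suc n) → ℤ) →
    sumOver (signedPerms (suc n)) F
      ≡ sumOver (signedPerms n) (λ τ → ∑[ i < suc n ] (F (insert τ (i , false)) + F (insert τ (i , true))))
  sumOver-signedPerms-insert F = begin
    sumOver (signedPerms (suc n)) F
      ≡⟨ sumOver-unique (signedPerms-unique (suc n)) insertions-unique (mk⇔ ∈-insertions ∈-signedPerms) F ⟩
    sumOver (map (uncurry insert) insertions) F
      ≡⟨ sumOver-map (uncurry insert) insertions F ⟩
    sumOver insertions (F ∘ uncurry insert)
      ≡⟨ sumOver-cartesianProduct (signedPerms n) choices _ ⟩
    sumOver (signedPerms n) (λ τ → sumOver choices (F ∘ insert τ))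
      ≡⟨ sumOver-cong (signedPerms n) (λ τ _ → sumOver-signs (F ∘ insert τ)) ⟩
    sumOver (signedPerms n) (λ τ → ∑[ i < suc n ] (F (insert τ (i , false)) + F (insert τ (i , true)))) ∎
    where
    open ≡-Reasoning
    choices = cartesianProduct (allFin (suc n)) (false ∷ true ∷ [])
    insertions = cartesianProduct (signedPerms n) choices

    insertions-unique : Unique (map (uncurry insert) insertions)
    insertions-unique = UniqueP.map⁺ insert-injective
      (UniqueP.cartesianProduct⁺ (signedPerms-unique n)
                                 (UniqueP.cartesianProduct⁺ (UniqueP.allFin⁺ (suc n)) bothSigns-unique))

    ∈-insertions : {σ : SignedWord (suc n)} → σ ∈ signedPerms (suc n) → σ ∈ map (uncurry insert) insertions
    ∈-insertions {σ} σ∈ = subst (_∈ map (uncurry insert) insertions) (insert-contract σ σ-perm)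
      (∈P.∈-map⁺ (uncurry insert) (∈P.∈-cartesianProduct⁺ (∈-signedPerms⁺ _ (contract-isSignedPerm σ σ-perm))
                                     (∈P.∈-cartesianProduct⁺ (∈P.∈-allFin (pivot σ σ-perm)) (∈-bothSigns _))))
      where σ-perm = ∈-signedPerms⁻ σ σ∈

    ∈-signedPerms : {σ : SignedWord (suc n)} → σ ∈ map (uncurry insert) insertions → σ ∈ signedPerms (suc n)
    ∈-signedPerms σ∈ with (τ , i , b) , τic∈ , refl ← ∈P.∈-map⁻ (uncurry insert) σ∈ =
      ∈-signedPerms⁺ _ (insert-isSignedPerm τ i b
        (∈-signedPerms⁻ τ (proj₁ (∈P.∈-cartesianProduct⁻ (signedPerms n) choices τic∈))))

module _ {m : ℕ} (k : Fin (suc (suc m))) where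
  open Insertion k

  isDerangementB-insert-punchIn : (τ : SignedWord (suc m)) (j : Fin (suc m)) (b : Bool) →
                                  isDerangementB (insert τ (punchIn k j , b)) ≡ unfixedAwayFrom j τ
  isDerangementB-insert-punchIn τ j b = begin
    isDerangementB σ
      ≡⟨ isDerangementB≡every σ ⟩
    every (not ∘ fixedAt σ)
      ≡⟨ every-remove k (not ∘ fixedAt σ) ⟩
    not (fixedAt σ k) ∧ every (not ∘ fixedAt σ ∘ punchIn k)
      ≡⟨ cong (λ c → not c ∧ every (not ∘ fixedAt σ ∘ punchIn k)) (fixedAt-insert-at-k τ i b k≢i) ⟩
    every (not ∘ fixedAt σ ∘ punchIn k)
      ≡⟨ every-remove j (not ∘ fixedAt σ ∘ punchIn k) ⟩
    not (fixedAt σ i) ∧ every (not ∘ fixedAt σ ∘ punchIn k ∘ punchIn j)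
      ≡⟨ cong (λ c → not c ∧ every (not ∘ fixedAt σ ∘ punchIn k ∘ punchIn j)) (fixedAt-insert-at-i τ i b k≢i) ⟩
    every (not ∘ fixedAt σ ∘ punchIn k ∘ punchIn j)
      ≡⟨ every-cong (λ a → cong not (fixedAt-insert τ i b (punchIn j a) (away a))) ⟩
    unfixedAwayFrom j τ ∎
    where
    open ≡-Reasoning
    i = punchIn k j
    σ = insert τ (i , b)
    k≢i : k ≢ i
    k≢i = FinP.punchInᵢ≢i k j ∘ sym
    away : (a : Fin m) → punchIn k (punchIn j a) ≢ i
    away a = FinP.punchInᵢ≢i j a ∘ FinP.punchIn-injective k _ _

module _ (m : ℕ) (j : Fin (suc m)) (q : ℤ) where
  open Insertion j

  private
    G : SignedWord (suc m) → ℤ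
    G = fixedOnlyAt-term q j

  fixedOnlyAt-term-unfixed : (σ : SignedWord (suc m)) → fixedAt σ j ≡ false → G σ ≡ + 0
  fixedOnlyAt-term-unfixed σ unfixed rewrite unfixed = refl

  fixedOnlyAt-term-insert-self : (τ : SignedWord m) → G (insert τ (j , false)) ≡ dB-term q τ
  fixedOnlyAt-term-insert-self τ =
    cong₂ (λ c e → if c then q ℤ.^ e else + 0) (cong₂ _∧_ fixed-j unfixed-away) (excB-insert-self τ false)
    where
    σ = insert τ (j , false)
    fixed-j : fixedAt σ j ≡ true
    fixed-j = trans (cong (λ u → ⌊ val u ℤ.≟ pos j ⌋) (insert-at-i τ j false)) (fixedAt-letter j false)
    unfixed-away : unfixedAwayFrom j σ ≡ isDerangementB τ
    unfixed-away = trans (every-cong (λ x → cong not (fixedAt-insert τ j false x (FinP.punchInᵢ≢i j x))))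
                         (sym (isDerangementB≡every τ))

  fixedOnlyAt-term-insert-negated : (τ : SignedWord m) → G (insert τ (j , true)) ≡ + 0
  fixedOnlyAt-term-insert-negated τ = fixedOnlyAt-term-unfixed (insert τ (j , true))
    (trans (cong (λ u → ⌊ val u ℤ.≟ pos j ⌋) (insert-at-i τ j true)) (fixedAt-letter j true))

  fixedOnlyAt-term-insert-elsewhere : (τ : SignedWord m) (a : Fin m) (b : Bool) → G (insert τ (punchIn j a , b)) ≡ + 0
  fixedOnlyAt-term-insert-elsewhere τ a b = fixedOnlyAt-term-unfixed (insert τ (punchIn j a , b))
    (fixedAt-insert-at-k τ (punchIn j a) b (FinP.punchInᵢ≢i j a ∘ sym))

  ∑-fixedOnlyAt-term-insert : (τ : SignedWord m) →
                              ∑[ i < suc m ] (G (insert τ (i , false)) + G (insert τ (i , true))) ≡ dB-term q τ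
  ∑-fixedOnlyAt-term-insert τ = begin
    ∑[ i < suc m ] (G (insert τ (i , false)) + G (insert τ (i , true)))
      ≡⟨ ℤΣ.sum-remove {i = j} (λ i → G (insert τ (i , false)) + G (insert τ (i , true))) ⟩
    G (insert τ (j , false)) + G (insert τ (j , true))
      + ∑[ a < m ] (G (insert τ (punchIn j a , false)) + G (insert τ (punchIn j a , true)))
      ≡⟨ cong₂ _+_ (cong₂ _+_ (fixedOnlyAt-term-insert-self τ) (fixedOnlyAt-term-insert-negated τ))
                   (trans (ℤΣ.sum-cong-≗ (λ a → cong₂ _+_ (fixedOnlyAt-term-insert-elsewhere τ a false)
                                                          (fixedOnlyAt-term-insert-elsewhere τ a true)))
                          (ℤΣ.sum-replicate-zero m)) ⟩
    dB-term q τ + + 0 + + 0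
      ≡⟨ trans (ℤP.+-identityʳ _) (ℤP.+-identityʳ _) ⟩
    dB-term q τ ∎
    where open ≡-Reasoning

  sumOver-fixedOnlyAt-term : sumOver (signedPerms (suc m)) G ≡ dB m q
  sumOver-fixedOnlyAt-term = begin
    sumOver (signedPerms (suc m)) G
      ≡⟨ sumOver-signedPerms-insert G ⟩
    sumOver (signedPerms m) (λ τ → ∑[ i < suc m ] (G (insert τ (i , false)) + G (insert τ (i , true))))
      ≡⟨ sumOver-cong (signedPerms m) (λ τ _ → ∑-fixedOnlyAt-term-insert τ) ⟩
    sumOver (signedPerms m) (dB-term q)
      ≡⟨ dB≡sumOver m q ⟨
    dB m q ∎
    where open ≡-Reasoning

module LastInsertion (n : ℕ) where

  last : Fin (suc n)
  last = fromℕ n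

  open Insertion last

  punchIn-last< : (a : Fin n) → punchIn last a Fin.< last
  punchIn-last< a = FinP.≤∧≢⇒< (FinP.≤fromℕ _) (FinP.punchInᵢ≢i last a)

  liftLetter<last : (u : SignedLetter n) (b : Bool) → ⌊ val (liftLetter u) ℤ.<? val (last , b) ⌋ ≡ not b
  liftLetter<last (a , false) false = ⌊⌋-true (val (liftLetter (a , false)) ℤ.<? val (last , false)) (ℤ.+<+ (ℕ.s≤s (punchIn-last< a)))
  liftLetter<last (a , true)  false = ⌊⌋-true (val (liftLetter (a , true)) ℤ.<? val (last , false)) ℤ.-<+
  liftLetter<last (a , false) true  = ⌊⌋-false (val (liftLetter (a , false)) ℤ.<? val (last , true)) (λ ())
  liftLetter<last (a , true)  true  = ⌊⌋-false (val (liftLetter (a , true)) ℤ.<? val (last , true))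
    (λ { (ℤ.-<- last<a↑) → ℕP.<-asym last<a↑ (punchIn-last< a) })

  last<liftLetter : (u : SignedLetter n) (b : Bool) → ⌊ val (last , b) ℤ.<? val (liftLetter u) ⌋ ≡ b
  last<liftLetter (a , false) true  = ⌊⌋-true (val (last , true) ℤ.<? val (liftLetter (a , false))) ℤ.-<+
  last<liftLetter (a , true)  true  = ⌊⌋-true (val (last , true) ℤ.<? val (liftLetter (a , true))) (ℤ.-<- (punchIn-last< a))
  last<liftLetter (a , false) false = ⌊⌋-false (val (last , false) ℤ.<? val (liftLetter (a , false)))
    (λ { (ℤ.+<+ (ℕ.s≤s last<a↑)) → ℕP.<-asym last<a↑ (punchIn-last< a) })
  last<liftLetter (a , true)  false = ⌊⌋-false (val (last , false) ℤ.<? val (liftLetter (a , true))) (λ ())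

  module _ (τ : SignedWord n) (τ-perm : IsSignedPerm τ) (p : Fin n) (b : Bool) where

    private
      j = ∣ τ ∣ p
      i = punchIn last j
      σ = insert τ (i , b)
      h : Fin n → Bool
      h x = isExcB σ (transpose last i (punchIn last x))

    excB-insert-after : excB σ ℕ.+ indicator (isExcB τ p) ≡ suc (excB τ)
    excB-insert-after = begin
      excB σ ℕ.+ indicator (isExcB τ p)
        ≡⟨ cong (ℕ._+ indicator (isExcB τ p)) (excB-insert τ i b) ⟩
      indicator (isExcB σ i) ℕ.+ count h ℕ.+ indicator (isExcB τ p)
        ≡⟨ cong (λ c → indicator c ℕ.+ count h ℕ.+ indicator (isExcB τ p)) new-letter ⟩
      indicator b ℕ.+ count h ℕ.+ indicator (isExcB τ p)
        ≡⟨ ℕP.+-assoc (indicator b) (count h) _ ⟩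
      indicator b ℕ.+ (count h ℕ.+ indicator (isExcB τ p))
        ≡⟨ cong (indicator b ℕ.+_) (count-update p h (isExcB τ) h-away) ⟩
      indicator b ℕ.+ (count (isExcB τ) ℕ.+ indicator (h p))
        ≡⟨ cong₂ (λ e c → indicator b ℕ.+ (e ℕ.+ indicator c)) (sym (excB≡count τ)) h-p ⟩
      indicator b ℕ.+ (excB τ ℕ.+ indicator (not b))
        ≡⟨ indicator-complement b (excB τ) ⟩
      suc (excB τ) ∎
      where
      open ≡-Reasoning
      last≢i : last ≢ i
      last≢i = FinP.punchInᵢ≢i last j ∘ sym

      new-letter : isExcB σ i ≡ b
      new-letter = trans (isExcB-via σ i (insert-at-i τ i b) σ-last)
        (cong₂ _∨_ (⌊⌋-false (val (last , b) ℤ.≟ ℤ.- pos i) (last≢i ∘ cong proj₁ ∘ val-injective {u = last , b} {i , true}))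
                   (last<liftLetter (lookup τ j) b))
        where
        σ-last : lookup σ last ≡ liftLetter (lookup τ j)
        σ-last = trans (cong (lookup σ) (sym (transpose-applyʳ last i))) (insert-at-transposed τ i b j)

      h-away : (x : Fin n) → x ≢ p → h x ≡ isExcB τ x
      h-away x x≢p = isExcB-insert τ i b x (x≢p ∘ τ-perm ∘ FinP.punchIn-injective last _ _)

      h-p : h p ≡ not b
      h-p = trans (isExcB-via σ z (insert-at-transposed τ i b p) (insert-at-i τ i b))
        (cong₂ _∨_ (⌊⌋-false (val (liftLetter (lookup τ p)) ℤ.≟ ℤ.- pos z) not-negated-fixed) (liftLetter<last (lookup τ p) b))
        where
        z = transpose last i (punchIn last p)
        not-negated-fixed : val (liftLetter (lookup τ p)) ≢ ℤ.- pos z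
        not-negated-fixed eq = FinP.punchInᵢ≢i last p (sym (transpose-injective last i
          (trans (transpose-applyˡ last i) (cong proj₁ (val-injective {u = liftLetter (lookup τ p)} {z , true} eq)))))

module Recurrence (m : ℕ) (q : ℤ) where

  open LastInsertion (suc m)
  open Insertion last

  α β : ℤ
  α = + (2 ℕ.* suc (suc m) ℕ.∸ 1) * q
  β = + 2 * q * (+ 1 - q)

  module _ (τ : SignedWord (suc m)) (τ-perm : IsSignedPerm τ) where

    private
      E = excB τ
      P = q ℤ.^ E
      D = isDerangementB τ

    insertionWeight : Fin (suc (suc m)) → ℤ
    insertionWeight i = dB-term q (insert τ (i , false)) + dB-term q (insert τ (i , true))

    weightAfter : Fin (suc m) → ℤ
    weightAfter j = q ℤ.^ excB (insert τ (punchIn last j , false)) + q ℤ.^ excB (insert τ (punchIn last j , true))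

    insertionWeight-last : insertionWeight last ≡ (if D then q * P else + 0)
    insertionWeight-last = trans (cong₂ _+_ negative positive) (ℤP.+-identityˡ _)
      where
      negative : dB-term q (insert τ (last , false)) ≡ + 0
      negative = cong (λ c → if c then q ℤ.^ excB (insert τ (last , false)) else + 0) (isDerangementB-insert-self τ false)
      positive : dB-term q (insert τ (last , true)) ≡ (if D then q * P else + 0)
      positive = cong₂ (λ c e → if c then q ℤ.^ e else + 0) (isDerangementB-insert-self τ true) (excB-insert-self τ true)

    insertionWeight-punchIn : (j : Fin (suc m)) →
                   insertionWeight (punchIn last j)
                     ≡ (if D then weightAfter j else + 0) + (if fixedOnlyAt j τ then weightAfter j else + 0)
    insertionWeight-punchIn j = begin
      insertionWeight (punchIn last j)
        ≡⟨ cong₂ _+_ (derangement false) (derangement true) ⟩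
      (if G then x⁻ else + 0) + (if G then x⁺ else + 0)
        ≡⟨ if-+ G x⁻ x⁺ ⟩
      (if G then weightAfter j else + 0)
        ≡⟨ if-∧-split (fixedAt τ j) G (weightAfter j) ⟩
      (if not (fixedAt τ j) ∧ G then weightAfter j else + 0) + (if fixedOnlyAt j τ then weightAfter j else + 0)
        ≡⟨ cong (λ c → (if c then weightAfter j else + 0) + (if fixedOnlyAt j τ then weightAfter j else + 0))
                (sym (trans (isDerangementB≡every τ) (every-remove j (not ∘ fixedAt τ)))) ⟩
      (if D then weightAfter j else + 0) + (if fixedOnlyAt j τ then weightAfter j else + 0) ∎
      where
      open ≡-Reasoning
      G = unfixedAwayFrom j τ
      derangement : (b : Bool) → dB-term q (insert τ (punchIn last j , b))
                                   ≡ (if G then q ℤ.^ excB (insert τ (punchIn last j , b)) else + 0)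
      derangement b = cong (λ c → if c then q ℤ.^ excB (insert τ (punchIn last j , b)) else + 0)
                           (isDerangementB-insert-punchIn last τ j b)
      x⁻ = q ℤ.^ excB (insert τ (punchIn last j , false))
      x⁺ = q ℤ.^ excB (insert τ (punchIn last j , true))

    excB-after : (p : Fin (suc m)) (b : Bool) →
                 excB (insert τ (punchIn last (∣ τ ∣ p) , b)) ≡ (if isExcB τ p then E else suc E)
    excB-after p b = +-indicator-cancel (isExcB τ p) (excB-insert-after τ τ-perm p b)

    weightAfter-image : (p : Fin (suc m)) → weightAfter (∣ τ ∣ p) ≡ (if isExcB τ p then + 2 * P else + 2 * (q * P))
    weightAfter-image p =
      trans (cong₂ (λ x y → q ℤ.^ x + q ℤ.^ y) (excB-after p false) (excB-after p true)) (doubled (isExcB τ p))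
      where
      doubled : (c : Bool) → q ℤ.^ (if c then E else suc E) + q ℤ.^ (if c then E else suc E)
                             ≡ (if c then + 2 * P else + 2 * (q * P))
      doubled true  = double P
      doubled false = double (q * P)

    ∑-weightAfter : ∑[ j < suc m ] weightAfter j + + E * (+ 2 * (q * P)) ≡ + E * (+ 2 * P) + + suc m * (+ 2 * (q * P))
    ∑-weightAfter = begin
      ∑[ j < suc m ] weightAfter j + + E * b
        ≡⟨ cong (_+ + E * b) (∑-reindex ∣ τ ∣ τ-perm weightAfter) ⟨
      ∑[ p < suc m ] weightAfter (∣ τ ∣ p) + + E * b
        ≡⟨ cong (_+ + E * b) (ℤΣ.sum-cong-≗ weightAfter-image) ⟩
      ∑[ p < suc m ] (if isExcB τ p then a else b) + + E * b
        ≡⟨ cong (λ c → ∑[ p < suc m ] (if isExcB τ p then a else b) + + c * b) (excB≡count τ) ⟩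
      ∑[ p < suc m ] (if isExcB τ p then a else b) + + count (isExcB τ) * b
        ≡⟨ ∑-if (isExcB τ) a b ⟩
      + count (isExcB τ) * a + + suc m * b
        ≡⟨ cong (λ c → + c * a + + suc m * b) (excB≡count τ) ⟨
      + E * a + + suc m * b ∎
      where
      open ≡-Reasoning
      a = + 2 * P
      b = + 2 * (q * P)

    weightAfter-fixedOnlyAt : (j : Fin (suc m)) →
                              (if fixedOnlyAt j τ then weightAfter j else + 0) ≡ + 2 * q * (if fixedOnlyAt j τ then P else + 0)
    weightAfter-fixedOnlyAt j = if-factor (fixedOnlyAt j τ) (+ 2 * q) λ only-j → begin
      weightAfter j
        ≡⟨ cong weightAfter (sym (∣τ∣j≡j only-j)) ⟩
      weightAfter (∣ τ ∣ j)
        ≡⟨ weightAfter-image j ⟩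
      (if isExcB τ j then + 2 * P else + 2 * (q * P))
        ≡⟨ cong (λ c → if c then + 2 * P else + 2 * (q * P)) (not-excedance only-j) ⟩
      + 2 * (q * P)
        ≡⟨ ℤP.*-assoc (+ 2) q P ⟨
      + 2 * q * P ∎
      where
      open ≡-Reasoning
      τj≡ : fixedOnlyAt j τ ≡ true → lookup τ j ≡ (j , false)
      τj≡ only-j = fixedAt-true⁻ τ j (BoolP.∧-conicalˡ _ _ only-j)
      ∣τ∣j≡j : fixedOnlyAt j τ ≡ true → ∣ τ ∣ j ≡ j
      ∣τ∣j≡j only-j = cong proj₁ (τj≡ only-j)
      not-excedance : fixedOnlyAt j τ ≡ true → isExcB τ j ≡ false
      not-excedance only-j = trans (isExcB-via τ j (τj≡ only-j) (τj≡ only-j)) (excedanceTest-self j false)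

    collect : (d : Bool) (t : ℤ) →
              (if d then q * P else + 0) + (∑[ j < suc m ] (if d then weightAfter j else + 0) + t)
              ≡ α * (if d then P else + 0) + β * (if d then + E * q ℤ.^ (E ℕ.∸ 1) else + 0) + t
    collect false t = begin
      + 0 + ((∑[ j < suc m ] (+ 0)) + t) ≡⟨ cong (λ s → + 0 + (s + t)) (ℤΣ.sum-replicate-zero (suc m)) ⟩
      + 0 + (+ 0 + t)                    ≡⟨ zeros α β t ⟩
      α * + 0 + β * + 0 + t              ∎
      where
      open ≡-Reasoning
      zeros : ∀ a b t → + 0 + (+ 0 + t) ≡ a * + 0 + b * + 0 + t
      zeros = solve-∀
    collect true t = begin
      q * P + (∑[ j < suc m ] weightAfter j + t)
        ≡⟨ cong (λ s → q * P + (s + t)) (add-sub (∑[ j < suc m ] weightAfter j) (+ E * (+ 2 * (q * P)))) ⟩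
      q * P + (∑[ j < suc m ] weightAfter j + + E * (+ 2 * (q * P)) - + E * (+ 2 * (q * P)) + t)
        ≡⟨ cong (λ s → q * P + (s - + E * (+ 2 * (q * P)) + t)) ∑-weightAfter ⟩
      q * P + (+ E * (+ 2 * P) + + suc m * (+ 2 * (q * P)) - + E * (+ 2 * (q * P)) + t)
        ≡⟨ regroup q P (+ E) (+ suc m) t ⟩
      (+ 1 + + 2 * + suc m) * q * P + + 2 * (+ 1 - q) * (+ E * P) + t
        ≡⟨ cong₂ (λ c y → c * q * P + + 2 * (+ 1 - q) * y + t) (sym (odd-coefficient m)) (sym (derivative-shift q E)) ⟩
      + c * q * P + + 2 * (+ 1 - q) * (+ E * q ℤ.^ (E ℕ.∸ 1) * q) + t
        ≡⟨ reorder (+ c) q P (+ E * q ℤ.^ (E ℕ.∸ 1)) t ⟩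
      α * P + β * (+ E * q ℤ.^ (E ℕ.∸ 1)) + t
        ∎
      where
      open ≡-Reasoning
      c = 2 ℕ.* suc (suc m) ℕ.∸ 1
      add-sub : ∀ x y → x ≡ x + y - y
      add-sub = solve-∀
      regroup : ∀ q P e n t → q * P + (e * (+ 2 * P) + n * (+ 2 * (q * P)) - e * (+ 2 * (q * P)) + t)
                            ≡ (+ 1 + + 2 * n) * q * P + + 2 * (+ 1 - q) * (e * P) + t
      regroup = solve-∀
      reorder : ∀ c q P y t → c * q * P + + 2 * (+ 1 - q) * (y * q) + t ≡ c * q * P + + 2 * q * (+ 1 - q) * y + t
      reorder = solve-∀

    ∑-insertionWeight : ∑[ i < suc (suc m) ] insertionWeight i
                        ≡ α * dB-term q τ + β * dB′-term q τ + + 2 * q * ∑[ j < suc m ] fixedOnlyAt-term q j τ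
    ∑-insertionWeight = begin
      ∑[ i < suc (suc m) ] insertionWeight i
        ≡⟨ ℤΣ.sum-remove {i = last} insertionWeight ⟩
      insertionWeight last + ∑[ j < suc m ] insertionWeight (punchIn last j)
        ≡⟨ cong₂ _+_ insertionWeight-last (ℤΣ.sum-cong-≗ insertionWeight-punchIn) ⟩
      new-cycle + ∑[ j < suc m ] (derangement-part j + fixed-part j)
        ≡⟨ cong (_+_ new-cycle) (ℤΣ.∑-distrib-+ derangement-part fixed-part) ⟩
      new-cycle + (∑[ j < suc m ] derangement-part j + ∑[ j < suc m ] fixed-part j)
        ≡⟨ cong (λ s → new-cycle + (∑[ j < suc m ] derangement-part j + s)) fixed-parts ⟩
      new-cycle + (∑[ j < suc m ] derangement-part j + + 2 * q * ∑[ j < suc m ] fixedOnlyAt-term q j τ)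
        ≡⟨ collect D (+ 2 * q * ∑[ j < suc m ] fixedOnlyAt-term q j τ) ⟩
      α * dB-term q τ + β * dB′-term q τ + + 2 * q * ∑[ j < suc m ] fixedOnlyAt-term q j τ
        ∎
      where
      open ≡-Reasoning
      new-cycle = if D then q * P else + 0
      derangement-part fixed-part : Fin (suc m) → ℤ
      derangement-part j = if D then weightAfter j else + 0
      fixed-part j = if fixedOnlyAt j τ then weightAfter j else + 0
      fixed-parts : ∑[ j < suc m ] fixed-part j ≡ + 2 * q * ∑[ j < suc m ] fixedOnlyAt-term q j τ
      fixed-parts = trans (ℤΣ.sum-cong-≗ weightAfter-fixedOnlyAt)
                          (sym (ℤΣ.*-distribˡ-sum (+ 2 * q) (λ j → fixedOnlyAt-term q j τ)))

  sumOver-∑-fixedOnlyAt :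
    sumOver (signedPerms (suc m)) (λ τ → ∑[ j < suc m ] fixedOnlyAt-term q j τ) ≡ + suc m * dB m q
  sumOver-∑-fixedOnlyAt = begin
    sumOver (signedPerms (suc m)) (λ τ → ∑[ j < suc m ] fixedOnlyAt-term q j τ)
      ≡⟨ sumOver-∑-comm (signedPerms (suc m)) (λ τ j → fixedOnlyAt-term q j τ) ⟩
    ∑[ j < suc m ] sumOver (signedPerms (suc m)) (fixedOnlyAt-term q j)
      ≡⟨ ℤΣ.sum-cong-≗ (λ j → sumOver-fixedOnlyAt-term m j q) ⟩
    ∑[ j < suc m ] dB m q
      ≡⟨ ∑-const (suc m) (dB m q) ⟩
    + suc m * dB m q ∎
    where open ≡-Reasoning

  dB-recurrence : dB (suc (suc m)) q ≡ α * dB (suc m) q + β * dB′ (suc m) q + + 2 * q * (+ suc m * dB m q)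
  dB-recurrence = begin
    dB (suc (suc m)) q
      ≡⟨ dB≡sumOver (suc (suc m)) q ⟩
    sumOver (signedPerms (suc (suc m))) (dB-term q)
      ≡⟨ sumOver-signedPerms-insert (dB-term q) ⟩
    sumOver perms (λ τ → ∑[ i < suc (suc m) ] (dB-term q (insert τ (i , false)) + dB-term q (insert τ (i , true))))
      ≡⟨ sumOver-cong perms (λ τ τ∈perms → ∑-insertionWeight τ (∈-signedPerms⁻ τ τ∈perms)) ⟩
    sumOver perms (λ τ → α * dB-term q τ + β * dB′-term q τ + + 2 * q * ∑[ j < suc m ] fixedOnlyAt-term q j τ)
      ≡⟨ trans (sumOver-+ perms _ _) (cong₂ _+_ (sumOver-+ perms _ _) (sumOver-*ˡ perms (+ 2 * q) _)) ⟩
    sumOver perms (λ τ → α * dB-term q τ) + sumOver perms (λ τ → β * dB′-term q τ)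
      + + 2 * q * sumOver perms (λ τ → ∑[ j < suc m ] fixedOnlyAt-term q j τ)
      ≡⟨ cong₂ _+_ (cong₂ _+_ (trans (sumOver-*ˡ perms α (dB-term q)) (cong (α *_) (sym (dB≡sumOver (suc m) q))))
                              (trans (sumOver-*ˡ perms β (dB′-term q)) (cong (β *_) (sym (dB′≡sumOver m q)))))
                   (cong (+ 2 * q *_) sumOver-∑-fixedOnlyAt) ⟩
    α * dB (suc m) q + β * dB′ (suc m) q + + 2 * q * (+ suc m * dB m q)
      ∎
    where
    open ≡-Reasoning
    perms = signedPerms (suc m)

theorem4p2 : (n : ℕ) (q : ℤ) →
    dB (suc (suc n)) q ≡
      (+ (2 ℕ.* suc (suc n) ℕ.∸ 1)) * q * dB (suc n) q
      + (+ 2) * q * (+ 1 - q) * dB′ (suc n) q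
      + (+ 2) * (+ suc n) * q * dB n q
theorem4p2 n q = trans (Recurrence.dB-recurrence n q)
                       (cong (_+_ (α * dB (suc n) q + β * dB′ (suc n) q)) (commute q (+ suc n) (dB n q)))
  where
  open Recurrence n q using (α; β)
  commute : ∀ q c z → + 2 * q * (c * z) ≡ + 2 * c * q * z
  commute = solve-∀
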